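{- Let $\mathcal{P}$ be a two-dimensional pattern with weights. If $\mathrm{Poly}_{\mathcal{P}}(x,y)$ has a non-trivial strongly linear divisor, then $\mathcal{P}$ is not abelian rigid; that is, there exists a two-dimensional word $\mathbf{w}$ over a finite alphabet which is not fully periodic and satisfies $a_{\mathbf{w}}(\mathcal{P})=1$.
   Context: A figure with weights in $\mathbb{Z}^2$ is a finite set $\{(u,g_u): u\in F, g_u\in\mathbb{Z}\}$ with $F\subset\mathbb{Z}^2$ finite; a pattern with weights is the set of all integer translates (points shifted, weights kept) of a fixed figure with weights. The canonical figure $F_{\mathcal{P}}$ is the member of $\mathcal{P}$ whose points have nonnegative coordinates, with some point having first coordinate $0$ and some point having second coordinate $0$; $\mathrm{Poly}_{\mathcal{P}}(x,y)=\sum_{((t_1,t_2),g_t)\in F_{\mathcal{P}}} g_t x^{t_1}y^{t_2}$. For $v=(v_1,v_2)\in\mathbb{Z}^2$ and a natural number $n$, $l(v,n)=\sum_{i=0}^n x^{iv_1}y^{iv_2}$ is strongly linear; it is non-trivial if $v\ne0$ and $n\ge1$; divisibility is in the Laurent polynomial ring $\mathbb{Z}[x^{\pm1},y^{\pm1}]$. For a word $\mathbf{w}:\mathbb{Z}^2\to A=\{a_1,\dots,a_k\}$ and $F^w=\{(u_1,g_1),\dots,(u_l,g_l)\}$, the linear combination of $\mathbf{w}$ over $F^w$ is the formal expression $\sum_i g_i\mathbf{w}(u_i)\in\mathbb{Z}[a_1,\dots,a_k]$; $a_{\mathbf{w}}(\mathcal{P})$ is the number of distinct such combinations over $F^w\in\mathcal{P}$.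 A word is fully periodic if it has two linearly independent period vectors $p$ ($\mathbf{w}(x+p)=\mathbf{w}(x)$ for all $x$). $\mathcal{P}$ is abelian rigid if $a_{\mathbf{w}}(\mathcal{P})=1$ holds only for fully periodic words $\mathbf{w}$. -}

module Defs where

open import Data.Nat using (ℕ; zero; suc)
open import Data.Integer as ℤ using (ℤ; +_; _+_; _*_; -_; _-_)
open import Data.Integer.Properties using () renaming (_≟_ to _≟ℤ_)
open import Data.Product using (Σ; ∃; _×_; _,_; proj₁; proj₂)
open import Data.Product.Properties using (≡-dec)
open import Data.List using (List; []; _∷_; map; sum; concatMap; upTo)
open import Data.List.Relation.Unary.Unique.Propositional using (Unique)
open import Data.Fin using (Fin)
open import Data.Fin.Properties using () renaming (_≟_ to _≟F_)
open import Relation.Nullary using (¬_; yes; no)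
open import Relation.Binary.PropositionalEquality using (_≡_)
open import Relation.Binary.Definitions using (DecidableEquality)

Point : Set
Point = ℤ × ℤ

_≟P_ : DecidableEquality Point
_≟P_ = ≡-dec _≟ℤ_ _≟ℤ_

_+P_ : Point → Point → Point
(a , b) +P (c , d) = (a + c , b + d)

-- A figure with weights: a finite list of (point, weight) pairs whose points
-- are pairwise distinct (so it is a finite set {(u, g_u) : u ∈ F}).
RawFigure : Set
RawFigure = List (Point × ℤ)

IsFigure : RawFigure → Set
IsFigure F = Unique (map proj₁ F)

translate : Point → RawFigure → RawFigure
translate t F = map (λ { (u , g) → (u +P t , g) }) F

-- A pattern with weights is the set of all translates of a fixed figure F;
-- we represent the pattern by such a representative figure F.

-- Minimum of a list of integers (0 for the empty list; only relevant
-- for the empty figure).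
minℤ : List ℤ → ℤ
minℤ []       = + 0
minℤ (x ∷ []) = x
minℤ (x ∷ xs@(_ ∷ _)) = x ℤ.⊓ minℤ xs

-- The canonical figure of the pattern generated by F: the translate whose
-- points have nonnegative coordinates, with minimum first coordinate 0 and
-- minimum second coordinate 0.
canonical : RawFigure → RawFigure
canonical F =
  translate (- minℤ (map (λ p → proj₁ (proj₁ p)) F) ,
             - minℤ (map (λ p → proj₂ (proj₁ p)) F)) F

-- Laurent polynomials in x, y with integer coefficients, as finite lists of
-- terms (coefficient, (exponent of x, exponent of y)); two lists denote the
-- same Laurent polynomial iff their coefficient functions agree.
Laurent : Set
Laurent = List (ℤ × Point)

coeff : Laurent → Point → ℤ
coeff []             e = + 0
coeff ((c , e') ∷ p) e with e' ≟P e
... | yes _ = c + coeff p e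
... | no  _ = coeff p e

_*L_ : Laurent → Laurent → Laurent
p *L q = concatMap (λ { (c , e) → map (λ { (c' , e') → (c * c' , e +P e') }) q }) p

_∣L_ : Laurent → Laurent → Set
d ∣L p = Σ Laurent λ q → ∀ e → coeff (d *L q) e ≡ coeff p e

Poly : RawFigure → Laurent
Poly F = map (λ { (t , g) → (g , t) }) (canonical F)

strongLinear : Point → ℕ → Laurent
strongLinear (v₁ , v₂) n = map (λ i → (+ 1 , (+ i * v₁ , + i * v₂))) (upTo (suc n))

HasNontrivialStronglyLinearDivisor : RawFigure → Set
HasNontrivialStronglyLinearDivisor F =
  Σ Point λ v → Σ ℕ λ n → ¬ (v ≡ (+ 0 , + 0)) × (1 Data.Nat.≤ n) × (strongLinear v n ∣L Poly F)

Word : ℕ → Set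
Word k = Point → Fin k

-- The linear combination Σ g_i w(u_i) over a figure, as an element of
-- ℤ[a_1..a_k] (linear forms): coefficient of a_j.
linComb : ∀ {k} → Word k → RawFigure → Fin k → ℤ
linComb w []            j = + 0
linComb w ((u , g) ∷ F) j with w u ≟F j
... | yes _ = g + linComb w F j
... | no  _ = linComb w F j

-- a_w(P) = 1: all figures in the pattern (the translates of F) give the
-- same linear combination (there is at least one, F itself).
AbelianComplexityOne : ∀ {k} → Word k → RawFigure → Set
AbelianComplexityOne w F = ∀ t j → linComb w (translate t F) j ≡ linComb w F j

IsPeriod : ∀ {k} → Word k → Point → Set
IsPeriod w p = ∀ x → w (x +P p) ≡ w x

LinIndep : Point → Point → Set
LinIndep (p₁ , p₂) (q₁ , q₂) = ¬ (p₁ * q₂ - p₂ * q₁ ≡ + 0)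

FullyPeriodic : ∀ {k} → Word k → Set
FullyPeriodic w = Σ Point λ p → Σ Point λ q → LinIndep p q × IsPeriod w p × IsPeriod w q

-- Colour ℤ² with n + 1 letters so that every progression
-- z, z + v, …, z + n v uses each letter exactly once. Writing Poly_P = l(v, n) q, the weighted
-- number of occurrences of a letter in any translate of the figure is a q-weighted sum of such
-- progressions, hence the same for every translate, so a_w(P) = 1. For v = (a , b) with a ≠ 0,
-- colour x by (x₁ div a + [det(x, v) > 0]) mod (n + 1): the half-plane term forces every period
-- to be parallel to v, so the word is not fully periodic. The case a = 0 follows by exchanging
-- the coordinates.

module Submission where

open import Defs
open import Data.Nat as ℕ using (ℕ; zero; suc; s≤s; z≤n)
import Data.Nat.Properties as ℕ
import Data.Nat.DivMod as ℕ
open import Data.Integer as ℤ using (ℤ; +_; -[1+_]; _+_; _*_; -_; _-_; _/_; _%_; _%ℕ_; _/ℕ_)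
open import Data.Integer.Properties
open import Data.Integer.DivMod using (n%d<d; a≡a%n+[a/n]*n; n%ℕd<d; a≡a%ℕn+[a/ℕn]*n)
open import Data.Integer.Tactic.RingSolver using (solve-∀)
open import Algebra.Properties.AbelianGroup +-0-abelianGroup using (∙-cancelʳ)
open import Data.Product using (Σ; _×_; _,_; proj₁; proj₂)
open import Data.Sum using (inj₁; inj₂)
open import Data.List using (List; []; _∷_; map; _++_; length; applyUpTo)
open import Data.Fin using (Fin; toℕ; fromℕ<)
open import Data.Fin.Properties using (toℕ-injective; toℕ<n; toℕ-fromℕ<) renaming (_≟_ to _≟F_)
open import Data.Empty using (⊥-elim)
open import Function using (_∘_)
open import Relation.Nullary using (¬_; Dec; yes; no)
open import Relation.Binary.Definitions using (tri<; tri≈; tri>)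
open import Relation.Binary.PropositionalEquality

δℕ : ℕ → ℕ → ℤ
δℕ zero    zero    = + 1
δℕ zero    (suc _) = + 0
δℕ (suc _) zero    = + 0
δℕ (suc m) (suc n) = δℕ m n

δℕ-refl : ∀ m → δℕ m m ≡ + 1
δℕ-refl zero    = refl
δℕ-refl (suc m) = δℕ-refl m

δℕ-≢ : ∀ {m n} → m ≢ n → δℕ m n ≡ + 0
δℕ-≢ {zero}  {zero}  m≢n = ⊥-elim (m≢n refl)
δℕ-≢ {zero}  {suc n} _   = refl
δℕ-≢ {suc m} {zero}  _   = refl
δℕ-≢ {suc m} {suc n} m≢n = δℕ-≢ (m≢n ∘ cong suc)

δ : ∀ {k} → Fin k → Fin k → ℤ
δ x y = δℕ (toℕ x) (toℕ y)

δ-≢ : ∀ {k} {x y : Fin k} → x ≢ y → δ x y ≡ + 0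
δ-≢ x≢y = δℕ-≢ (x≢y ∘ toℕ-injective)

-P_ : Point → Point
-P (a , b) = (- a , - b)

_-P_ : Point → Point → Point
p -P q = p +P (-P q)

infixr 7 _·P_

_·P_ : ℤ → Point → Point
k ·P (a , b) = (k * a , k * b)

0P : Point
0P = (+ 0 , + 0)

+P-assoc : ∀ p q r → (p +P q) +P r ≡ p +P (q +P r)
+P-assoc (p₁ , p₂) (q₁ , q₂) (r₁ , r₂) = cong₂ _,_ (+-assoc p₁ q₁ r₁) (+-assoc p₂ q₂ r₂)

+P-identityʳ : ∀ p → p +P 0P ≡ p
+P-identityʳ (p₁ , p₂) = cong₂ _,_ (+-identityʳ p₁) (+-identityʳ p₂)

+P-through : ∀ u c t → u +P t ≡ (u +P c) +P (t -P c)
+P-through (u₁ , u₂) (c₁ , c₂) (t₁ , t₂) = cong₂ _,_ (lemma u₁ c₁ t₁) (lemma u₂ c₂ t₂)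
  where
  lemma : ∀ u c t → u + t ≡ (u + c) + (t + - c)
  lemma = solve-∀

eval : Laurent → (Point → ℤ) → ℤ
eval []            φ = + 0
eval ((c , e) ∷ p) φ = c * φ e + eval p φ

eval-cong : ∀ p {φ ψ : Point → ℤ} → (∀ e → φ e ≡ ψ e) → eval p φ ≡ eval p ψ
eval-cong []            φ≗ψ = refl
eval-cong ((c , e) ∷ p) φ≗ψ = cong₂ _+_ (cong (c *_) (φ≗ψ e)) (eval-cong p φ≗ψ)

eval-++ : ∀ p q φ → eval (p ++ q) φ ≡ eval p φ + eval q φ
eval-++ []            q φ = sym (+-identityˡ _)
eval-++ ((c , e) ∷ p) q φ = trans (cong (_+_ (c * φ e)) (eval-++ p q φ)) (sym (+-assoc (c * φ e) _ _))

eval-zero : ∀ p → eval p (λ _ → + 0) ≡ + 0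
eval-zero []            = refl
eval-zero ((c , e) ∷ p) = cong₂ _+_ (*-zeroʳ c) (eval-zero p)

eval-+ : ∀ p (φ ψ : Point → ℤ) → eval p (λ e → φ e + ψ e) ≡ eval p φ + eval p ψ
eval-+ []            φ ψ = refl
eval-+ ((c , e) ∷ p) φ ψ =
  trans (cong₂ _+_ (*-distribˡ-+ c (φ e) (ψ e)) (eval-+ p φ ψ)) (lemma (c * φ e) (c * ψ e) _ _)
  where
  lemma : ∀ a b c d → (a + b) + (c + d) ≡ (a + c) + (b + d)
  lemma = solve-∀

eval-*ˡ : ∀ p k (φ : Point → ℤ) → eval p (λ e → k * φ e) ≡ k * eval p φ
eval-*ˡ []            k φ = sym (*-zeroʳ k)
eval-*ˡ ((c , e) ∷ p) k φ = trans (cong (_+_ (c * (k * φ e))) (eval-*ˡ p k φ)) (lemma c k (φ e) (eval p φ))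
  where
  lemma : ∀ c k x y → c * (k * x) + k * y ≡ k * (c * x + y)
  lemma = solve-∀

eval-comm : ∀ p q (ψ : Point → Point → ℤ) →
            eval p (λ e → eval q (ψ e)) ≡ eval q (λ e′ → eval p (λ e → ψ e e′))
eval-comm []            q ψ = sym (eval-zero q)
eval-comm ((c , e) ∷ p) q ψ = sym (begin
  eval q (λ e′ → c * ψ e e′ + eval p (λ e₁ → ψ e₁ e′))
    ≡⟨ eval-+ q (λ e′ → c * ψ e e′) (λ e′ → eval p (λ e₁ → ψ e₁ e′)) ⟩
  eval q (λ e′ → c * ψ e e′) + eval q (λ e′ → eval p (λ e₁ → ψ e₁ e′))
    ≡⟨ cong₂ _+_ (eval-*ˡ q c (ψ e)) (sym (eval-comm p q ψ)) ⟩
  c * eval q (ψ e) + eval p (λ e₁ → eval q (ψ e₁)) ∎)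
  where open ≡-Reasoning

eval-*L : ∀ p q φ → eval (p *L q) φ ≡ eval p (λ e → eval q (λ e′ → φ (e +P e′)))
eval-*L []            q φ = refl
eval-*L ((c , e) ∷ p) q φ =
  trans (eval-++ (map (λ t → (c * proj₁ t , e +P proj₂ t)) q) (p *L q) φ)
        (cong₂ _+_ (eval-scale q) (eval-*L p q φ))
  where
  eval-scale : ∀ r → eval (map (λ t → (c * proj₁ t , e +P proj₂ t)) r) φ
                   ≡ c * eval r (λ e′ → φ (e +P e′))
  eval-scale []              = sym (*-zeroʳ c)
  eval-scale ((c′ , e′) ∷ r) =
    trans (cong₂ _+_ (*-assoc c c′ _) (eval-scale r)) (sym (*-distribˡ-+ c _ _))

coeff-head-≡ : ∀ c e p → coeff ((c , e) ∷ p) e ≡ c + coeff p e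
coeff-head-≡ c e p with e ≟P e
... | yes _   = refl
... | no  e≢e = ⊥-elim (e≢e refl)

coeff-head-≢ : ∀ c {e e′} p → e ≢ e′ → coeff ((c , e) ∷ p) e′ ≡ coeff p e′
coeff-head-≢ c {e} {e′} p e≢e′ with e ≟P e′
... | yes e≡e′ = ⊥-elim (e≢e′ e≡e′)
... | no  _    = refl

remove : Point → Laurent → Laurent
remove e [] = []
remove e ((c , e′) ∷ p) with e′ ≟P e
... | yes _ = remove e p
... | no  _ = (c , e′) ∷ remove e p

eval-remove : ∀ e p φ → eval p φ ≡ coeff p e * φ e + eval (remove e p) φ
eval-remove e []             φ = sym (+-identityʳ _)
eval-remove e ((c , e′) ∷ p) φ with e′ ≟P e
... | yes refl = trans (cong (_+_ (c * φ e)) (eval-remove e p φ)) (lemma c _ _ _)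
  where
  lemma : ∀ c x a b → c * x + (a * x + b) ≡ (c + a) * x + b
  lemma = solve-∀
... | no  _    = trans (cong (_+_ (c * φ e′)) (eval-remove e p φ)) (lemma (c * φ e′) (coeff p e * φ e) (eval (remove e p) φ))
  where
  lemma : ∀ x y z → x + (y + z) ≡ y + (x + z)
  lemma = solve-∀

coeff-remove-≡ : ∀ e p → coeff (remove e p) e ≡ + 0
coeff-remove-≡ e []             = refl
coeff-remove-≡ e ((c , e′) ∷ p) with e′ ≟P e
... | yes _    = coeff-remove-≡ e p
... | no e′≢e = trans (coeff-head-≢ c (remove e p) e′≢e) (coeff-remove-≡ e p)

coeff-remove-≢ : ∀ {e e″} p → e ≢ e″ → coeff (remove e p) e″ ≡ coeff p e″
coeff-remove-≢ []             _    = refl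
coeff-remove-≢ {e} {e″} ((c , e′) ∷ p) e≢e″ with e′ ≟P e
... | yes refl = trans (coeff-remove-≢ p e≢e″) (sym (coeff-head-≢ c p e≢e″))
... | no  _ with e′ ≟P e″
...   | yes _ = cong (_+_ c) (coeff-remove-≢ p e≢e″)
...   | no  _ = coeff-remove-≢ p e≢e″

length-remove : ∀ e p → length (remove e p) ℕ.≤ length p
length-remove e []             = z≤n
length-remove e ((c , e′) ∷ p) with e′ ≟P e
... | yes _ = ℕ.m≤n⇒m≤1+n (length-remove e p)
... | no  _ = s≤s (length-remove e p)

-- remove e p is not a structural subterm of (c , e) ∷ p, hence the bound on the length.
eval-coeff-zero : ∀ p → (∀ e → coeff p e ≡ + 0) → ∀ φ → eval p φ ≡ + 0
eval-coeff-zero p = bounded (length p) p ℕ.≤-refl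
  where
  bounded : ∀ k p → length p ℕ.≤ k → (∀ e → coeff p e ≡ + 0) → ∀ φ → eval p φ ≡ + 0
  bounded _       []            _       _    _ = refl
  bounded (suc k) ((c , e) ∷ p) (s≤s ∣p∣≤k) all-zero φ = begin
    c * φ e + eval p φ                                ≡⟨ cong (_+_ (c * φ e)) (eval-remove e p φ) ⟩
    c * φ e + (coeff p e * φ e + eval (remove e p) φ) ≡⟨ regroup c (coeff p e) (φ e) _ ⟩
    (c + coeff p e) * φ e + eval (remove e p) φ       ≡⟨ cong₂ (λ a b → a * φ e + b)
                                                           (trans (sym (coeff-head-≡ c e p)) (all-zero e))
                                                           (bounded k (remove e p) ∣rest∣≤k zero′ φ) ⟩
    + 0 * φ e + + 0                                    ≡⟨ +-identityʳ _ ⟩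
    + 0 * φ e                                          ≡⟨ *-zeroˡ (φ e) ⟩
    + 0                                                ∎
    where
    open ≡-Reasoning
    regroup : ∀ c a x b → c * x + (a * x + b) ≡ (c + a) * x + b
    regroup = solve-∀
    ∣rest∣≤k : length (remove e p) ℕ.≤ k
    ∣rest∣≤k = ℕ.≤-trans (length-remove e p) ∣p∣≤k
    zero′ : ∀ e″ → coeff (remove e p) e″ ≡ + 0
    zero′ e″ with e ≟P e″
    ... | yes refl = coeff-remove-≡ e p
    ... | no e≢e″  = trans (coeff-remove-≢ p e≢e″) (trans (sym (coeff-head-≢ c p e≢e″)) (all-zero e″))

-- Induction on p, moving each head term to the other side with the opposite sign.
eval-coeff-cong : ∀ p q → (∀ e → coeff p e ≡ coeff q e) → ∀ φ → eval p φ ≡ eval q φ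
eval-coeff-cong []            q p≈q φ = sym (eval-coeff-zero q (λ e → sym (p≈q e)) φ)
eval-coeff-cong ((c , e) ∷ p) q p≈q φ =
  trans (cong (_+_ (c * φ e)) (eval-coeff-cong p ((- c , e) ∷ q) p≈q′ φ)) (cancel c (φ e) (eval q φ))
  where
  cancel : ∀ c x y → c * x + (- c * x + y) ≡ y
  cancel = solve-∀
  p≈q′ : ∀ e′ → coeff p e′ ≡ coeff ((- c , e) ∷ q) e′
  p≈q′ e′ with e ≟P e′ | p≈q e′
  ... | yes _ | c+p≡q = trans (lemma c _) (cong (_+_ (- c)) c+p≡q)
    where
    lemma : ∀ c x → x ≡ - c + (c + x)
    lemma = solve-∀
  ... | no _  | p≡q   = p≡q

evalFig : RawFigure → (Point → ℤ) → ℤ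
evalFig []            f = + 0
evalFig ((u , g) ∷ G) f = g * f u + evalFig G f

evalFig-cong : ∀ G {f f′ : Point → ℤ} → (∀ u → f u ≡ f′ u) → evalFig G f ≡ evalFig G f′
evalFig-cong []            f≗f′ = refl
evalFig-cong ((u , g) ∷ G) f≗f′ = cong₂ _+_ (cong (g *_) (f≗f′ u)) (evalFig-cong G f≗f′)

evalFig-translate : ∀ t G f → evalFig (translate t G) f ≡ evalFig G (λ u → f (u +P t))
evalFig-translate t []            f = refl
evalFig-translate t ((u , g) ∷ G) f = cong (_+_ (g * f (u +P t))) (evalFig-translate t G f)

eval-termsOf : ∀ G φ → eval (map (λ t → (proj₂ t , proj₁ t)) G) φ ≡ evalFig G φ
eval-termsOf []            φ = refl
eval-termsOf ((u , g) ∷ G) φ = cong (_+_ (g * φ u)) (eval-termsOf G φ)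

linComb≡evalFig : ∀ {k} (w : Word k) G j → linComb w G j ≡ evalFig G (λ u → δ (w u) j)
linComb≡evalFig w []            j = refl
linComb≡evalFig w ((u , g) ∷ G) j with w u ≟F j
... | yes refl = cong₂ _+_ (sym (trans (cong (g *_) (δℕ-refl (toℕ j))) (*-identityʳ g)))
                           (linComb≡evalFig w G j)
... | no  wu≢j = trans (linComb≡evalFig w G j)
                       (sym (trans (cong (λ x → g * x + _) (δ-≢ wu≢j))
                                   (trans (cong (_+ _) (*-zeroʳ g)) (+-identityˡ _))))

Balanced : ∀ {k} → Word k → Laurent → Set
Balanced w d = ∀ j z z′ → eval d (λ e → δ (w (e +P z)) j) ≡ eval d (λ e → δ (w (e +P z′)) j)

-- Writing Poly F = d q, the count of a letter in a translate of F is a q-combination of d-windows.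
balanced-divisor⇒abelianComplexityOne : ∀ {k} (w : Word k) F d →
  d ∣L Poly F → Balanced w d → AbelianComplexityOne w F
balanced-divisor⇒abelianComplexityOne w F d (q , dq≈Poly) balanced t j = begin
  linComb w (translate t F) j   ≡⟨ viaWindows t ⟩
  eval q (window t)             ≡⟨ eval-cong q (λ e′ → balanced j (e′ +P shift t) (e′ +P shift 0P)) ⟩
  eval q (window 0P)            ≡⟨ viaWindows 0P ⟨
  linComb w (translate 0P F) j  ≡⟨ cong (λ G → linComb w G j) (translate-identity F) ⟩
  linComb w F j                 ∎
  where
  open ≡-Reasoning
  canonicalShift : Point
  canonicalShift = (- minℤ (map (λ p → proj₁ (proj₁ p)) F) , - minℤ (map (λ p → proj₂ (proj₁ p)) F))
  shift : Point → Point
  shift t = t -P canonicalShift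
  χ : Point → ℤ
  χ u = δ (w u) j
  window : Point → Point → ℤ
  window t e′ = eval d (λ e → χ (e +P (e′ +P shift t)))
  translate-identity : ∀ G → translate 0P G ≡ G
  translate-identity []            = refl
  translate-identity ((u , g) ∷ G) = cong₂ (λ u′ G′ → (u′ , g) ∷ G′) (+P-identityʳ u) (translate-identity G)
  viaWindows : ∀ t → linComb w (translate t F) j ≡ eval q (window t)
  viaWindows t = let s = shift t in begin
    linComb w (translate t F) j                        ≡⟨ linComb≡evalFig w (translate t F) j ⟩
    evalFig (translate t F) χ                          ≡⟨ evalFig-translate t F χ ⟩
    evalFig F (λ u → χ (u +P t))                       ≡⟨ evalFig-cong F (λ u → cong χ (+P-through u canonicalShift t)) ⟩
    evalFig F (λ u → χ ((u +P canonicalShift) +P s))  ≡⟨ evalFig-translate canonicalShift F _ ⟨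
    evalFig (canonical F) (λ e → χ (e +P s))           ≡⟨ eval-termsOf (canonical F) _ ⟨
    eval (Poly F) (λ e → χ (e +P s))                   ≡⟨ eval-coeff-cong (d *L q) (Poly F) dq≈Poly _ ⟨
    eval (d *L q) (λ e → χ (e +P s))                   ≡⟨ eval-*L d q _ ⟩
    eval d (λ e → eval q (λ e′ → χ ((e +P e′) +P s)))  ≡⟨ eval-comm d q (λ e e′ → χ ((e +P e′) +P s)) ⟩
    eval q (λ e′ → eval d (λ e → χ ((e +P e′) +P s)))  ≡⟨ eval-cong q (λ e′ → eval-cong d (λ e → cong χ (+P-assoc e e′ s))) ⟩
    eval q (window t)                                  ∎

sumTo : ℕ → (ℕ → ℤ) → ℤ
sumTo zero    f = + 0
sumTo (suc m) f = f 0 + sumTo m (f ∘ suc)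

sumTo-cong : ∀ m {f g : ℕ → ℤ} → (∀ i → i ℕ.< m → f i ≡ g i) → sumTo m f ≡ sumTo m g
sumTo-cong zero    f≗g = refl
sumTo-cong (suc m) f≗g = cong₂ _+_ (f≗g 0 (s≤s z≤n)) (sumTo-cong m (λ i i<m → f≗g (suc i) (s≤s i<m)))

sumTo-zero : ∀ m → sumTo m (λ _ → + 0) ≡ + 0
sumTo-zero zero    = refl
sumTo-zero (suc m) = trans (+-identityˡ _) (sumTo-zero m)

sumTo-rotate : ∀ m (f : ℕ → ℤ) → sumTo m (f ∘ suc) + f 0 ≡ sumTo m f + f m
sumTo-rotate zero    f = refl
sumTo-rotate (suc m) f =
  trans (lemma (f 1) (sumTo m (f ∘ suc ∘ suc)) (f 0))
        (trans (cong (_+_ (f 0)) (sumTo-rotate m (f ∘ suc))) (sym (+-assoc (f 0) _ _)))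
  where
  lemma : ∀ a s b → (a + s) + b ≡ b + (s + a)
  lemma = solve-∀

sumTo-δℕ : ∀ m {j} → j ℕ.< m → sumTo m (λ i → δℕ i j) ≡ + 1
sumTo-δℕ (suc m) {zero}  _         = cong (_+_ (+ 1)) (sumTo-zero m)
sumTo-δℕ (suc m) {suc j} (s≤s j<m) = trans (+-identityˡ _) (sumTo-δℕ m j<m)

sumTo-δℕ-% : ∀ N .{{_ : ℕ.NonZero N}} r {j} → j ℕ.< N → sumTo N (λ i → δℕ ((r ℕ.+ i) ℕ.% N) j) ≡ + 1
sumTo-δℕ-% N zero    j<N =
  trans (sumTo-cong N (λ i i<N → cong (λ x → δℕ x _) (ℕ.m<n⇒m%n≡m i<N))) (sumTo-δℕ N j<N)
sumTo-δℕ-% N (suc r) {j} j<N = begin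
  sumTo N (λ i → δℕ ((suc r ℕ.+ i) ℕ.% N) j) ≡⟨ sumTo-cong N (λ i _ → cong (λ x → δℕ (x ℕ.% N) j) (sym (ℕ.+-suc r i))) ⟩
  sumTo N (f ∘ suc)                           ≡⟨ ∙-cancelʳ (f 0) _ _ (trans (sumTo-rotate N f) (cong (_+_ (sumTo N f)) fN≡f0)) ⟩
  sumTo N f                                   ≡⟨ sumTo-δℕ-% N r j<N ⟩
  + 1                                         ∎
  where
  open ≡-Reasoning
  f : ℕ → ℤ
  f i = δℕ ((r ℕ.+ i) ℕ.% N) j
  fN≡f0 : f N ≡ f 0
  fN≡f0 = cong (λ x → δℕ x j) (trans (ℕ.[m+n]%n≡m%n r N) (cong (ℕ._% N) (sym (ℕ.+-identityʳ r))))

Rainbow : ∀ {k} → Word k → Point → ℕ → Set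
Rainbow w v m = ∀ z j → sumTo m (λ i → δ (w ((+ i ·P v) +P z)) j) ≡ + 1

eval-strongLinear : ∀ v n φ → eval (strongLinear v n) φ ≡ sumTo (suc n) (λ i → φ (+ i ·P v))
eval-strongLinear v n φ = eval-applyUpTo (λ i → i) (suc n)
  where
  eval-applyUpTo : ∀ (f : ℕ → ℕ) m →
    eval (map (λ i → (+ 1 , (+ i ·P v))) (applyUpTo f m)) φ ≡ sumTo m (λ i → φ (+ f i ·P v))
  eval-applyUpTo f zero    = refl
  eval-applyUpTo f (suc m) = cong₂ _+_ (*-identityˡ (φ (+ f 0 ·P v))) (eval-applyUpTo (f ∘ suc) m)

rainbow⇒balanced : ∀ {k} (w : Word k) v n → Rainbow w v (suc n) → Balanced w (strongLinear v n)
rainbow⇒balanced w v n rainbow j z z′ = trans (letterCount z) (sym (letterCount z′))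
  where
  letterCount : ∀ z → eval (strongLinear v n) (λ e → δ (w (e +P z)) j) ≡ + 1
  letterCount z = trans (eval-strongLinear v n (λ e → δ (w (e +P z)) j)) (rainbow z j)

m*n<n⇒m≡0 : ∀ m n → m ℕ.* n ℕ.< n → m ≡ 0
m*n<n⇒m≡0 zero    n _       = refl
m*n<n⇒m≡0 (suc m) n m*n<n = ⊥-elim (ℕ.<-irrefl refl (ℕ.<-≤-trans m*n<n (ℕ.m≤n*m n (suc m))))

divMod-unique : ∀ a {r r′ q q′} → r ℕ.< ℤ.∣ a ∣ → r′ ℕ.< ℤ.∣ a ∣ →
                + r + q * a ≡ + r′ + q′ * a → q ≡ q′ × r ≡ r′
divMod-unique a {r} {r′} {q} {q′} r<∣a∣ r′<∣a∣ eq =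
  q≡q′ , +-injective (∙-cancelʳ (q′ * a) (+ r) (+ r′) (subst (λ x → + r + x * a ≡ _) q≡q′ eq))
  where
  expand : ∀ r q q′ a → (q - q′) * a ≡ (r + q * a) - (r + q′ * a)
  expand = solve-∀
  cancel : ∀ r r′ x → (r′ + x) - (r + x) ≡ r′ - r
  cancel = solve-∀
  diff : (q - q′) * a ≡ r′ ℤ.⊖ r
  diff = trans (expand (+ r) q q′ a)
        (trans (cong (_- (+ r + q′ * a)) eq) (trans (cancel (+ r) (+ r′) (q′ * a)) (m-n≡m⊖n r′ r)))
  ∣diff∣<∣a∣ : ℤ.∣ q - q′ ∣ ℕ.* ℤ.∣ a ∣ ℕ.< ℤ.∣ a ∣
  ∣diff∣<∣a∣ = ℕ.≤-<-trans (ℕ.≤-reflexive (trans (sym (abs-* (q - q′) a)) (cong ℤ.∣_∣ diff)))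
                          (ℕ.≤-<-trans (∣m⊝n∣≤m⊔n r′ r) (ℕ.⊔-lub r′<∣a∣ r<∣a∣))
  q≡q′ : q ≡ q′
  q≡q′ = i-j≡0⇒i≡j q q′ (∣i∣≡0⇒i≡0 (m*n<n⇒m≡0 _ _ ∣diff∣<∣a∣))

/-shift : ∀ a .{{_ : ℤ.NonZero a}} i x → (i * a + x) / a ≡ x / a + i
/-shift a i x = sym (proj₁ (divMod-unique a (n%d<d x a) (n%d<d (i * a + x) a)
  (trans (sym shifted) (a≡a%n+[a/n]*n (i * a + x) a))))
  where
  regroup : ∀ i a r q → i * a + (r + q * a) ≡ r + (q + i) * a
  regroup = solve-∀
  shifted : i * a + x ≡ + (x % a) + (x / a + i) * a
  shifted = trans (cong (_+_ (i * a)) (a≡a%n+[a/n]*n x a)) (regroup i a (+ (x % a)) (x / a))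

%ℕ-+ : ∀ N .{{_ : ℕ.NonZero N}} z i → (z + + i) %ℕ N ≡ (z %ℕ N ℕ.+ i) ℕ.% N
%ℕ-+ N z i = sym (proj₂ (divMod-unique (+ N) {q = q + + d} {q′ = (z + + i) /ℕ N} (ℕ.m%n<n (r ℕ.+ i) N) (n%ℕd<d (z + + i) N)
  (trans (sym shifted) (a≡a%ℕn+[a/ℕn]*n (z + + i) N))))
  where
  r : ℕ
  r = z %ℕ N
  q : ℤ
  q = z /ℕ N
  r′ : ℕ
  r′ = (r ℕ.+ i) ℕ.% N
  d : ℕ
  d = (r ℕ.+ i) ℕ./ N
  swap : ∀ r q n i → (r + q * n) + i ≡ (r + i) + q * n
  swap = solve-∀
  regroup : ∀ r′ d n q → (r′ + d * n) + q * n ≡ r′ + (q + d) * n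
  regroup = solve-∀
  shifted : z + + i ≡ + r′ + (q + + d) * + N
  shifted = begin
    z + + i                        ≡⟨ cong (_+ + i) (a≡a%ℕn+[a/ℕn]*n z N) ⟩
    (+ r + q * + N) + + i          ≡⟨ swap (+ r) q (+ N) (+ i) ⟩
    (+ r + + i) + q * + N          ≡⟨ cong (_+ q * + N) (sym (pos-+ r i)) ⟩
    + (r ℕ.+ i) + q * + N          ≡⟨ cong (λ x → + x + q * + N) (ℕ.m≡m%n+[m/n]*n (r ℕ.+ i) N) ⟩
    + (r′ ℕ.+ d ℕ.* N) + q * + N   ≡⟨ cong (_+ q * + N) (trans (pos-+ r′ (d ℕ.* N)) (cong (_+_ (+ r′)) (pos-* d N))) ⟩
    (+ r′ + + d * + N) + q * + N   ≡⟨ regroup (+ r′) (+ d) (+ N) q ⟩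
    + r′ + (q + + d) * + N         ∎
    where open ≡-Reasoning

det : Point → Point → ℤ
det (p₁ , p₂) (q₁ , q₂) = p₁ * q₂ - p₂ * q₁

det-neg : ∀ p v → det (-P p) v ≡ - det p v
det-neg (p₁ , p₂) (a , b) = lemma p₁ p₂ a b
  where
  lemma : ∀ p₁ p₂ a b → - p₁ * b - - p₂ * a ≡ - (p₁ * b - p₂ * a)
  lemma = solve-∀

i*j≡0⇒j≡0 : ∀ {i j} → i ≢ + 0 → i * j ≡ + 0 → j ≡ + 0
i*j≡0⇒j≡0 {i} i≢0 ij≡0 with i*j≡0⇒i≡0∨j≡0 i ij≡0
... | inj₁ i≡0 = ⊥-elim (i≢0 i≡0)
... | inj₂ j≡0 = j≡0

det-parallel : ∀ p q v → v ≢ 0P → det p v ≡ + 0 → det q v ≡ + 0 → det p q ≡ + 0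
det-parallel (p₁ , p₂) (q₁ , q₂) (a , b) v≢0 p∥v q∥v = byFirstCoordinate (a ≟ + 0)
  where
  viaFirst : ∀ p₁ p₂ q₁ q₂ a b → a * (p₁ * q₂ - p₂ * q₁) ≡ q₁ * (p₁ * b - p₂ * a) - p₁ * (q₁ * b - q₂ * a)
  viaFirst = solve-∀
  viaSecond : ∀ p₁ p₂ q₁ q₂ a b → b * (p₁ * q₂ - p₂ * q₁) ≡ q₂ * (p₁ * b - p₂ * a) - p₂ * (q₁ * b - q₂ * a)
  viaSecond = solve-∀
  vanishing : ∀ c d {x y} → x ≡ + 0 → y ≡ + 0 → c * x - d * y ≡ + 0
  vanishing c d refl refl = lemma c d
    where
    lemma : ∀ c d → c * + 0 - d * + 0 ≡ + 0
    lemma = solve-∀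
  byFirstCoordinate : Dec (a ≡ + 0) → p₁ * q₂ - p₂ * q₁ ≡ + 0
  byFirstCoordinate (no a≢0)  =
    i*j≡0⇒j≡0 a≢0 (trans (viaFirst p₁ p₂ q₁ q₂ a b) (vanishing q₁ p₁ p∥v q∥v))
  byFirstCoordinate (yes a≡0) =
    i*j≡0⇒j≡0 (λ b≡0 → v≢0 (cong₂ _,_ a≡0 b≡0)) (trans (viaSecond p₁ p₂ q₁ q₂ a b) (vanishing q₂ p₂ p∥v q∥v))

step : ℤ → ℤ
step m with + 0 ℤ.<? m
... | yes _ = + 1
... | no  _ = + 0

step-pos : ∀ {m} → + 0 ℤ.< m → step m ≡ + 1
step-pos {m} 0<m with + 0 ℤ.<? m
... | yes _   = refl
... | no  0≮m = ⊥-elim (0≮m 0<m)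

step-nonpos : ∀ {m} → m ℤ.≤ + 0 → step m ≡ + 0
step-nonpos {m} m≤0 with + 0 ℤ.<? m
... | yes 0<m = ⊥-elim (<-irrefl refl (<-≤-trans 0<m m≤0))
... | no  _   = refl

residue : ∀ N .{{_ : ℕ.NonZero N}} → ℤ → Fin N
residue N z = fromℕ< (n%ℕd<d z N)

residue-suc-≢ : ∀ N .{{_ : ℕ.NonZero N}} z → 2 ℕ.≤ N → residue N z ≢ residue N (z + + 1)
residue-suc-≢ N z 2≤N eq = r≢[r+1]%N (begin
  r                         ≡⟨ toℕ-fromℕ< (n%ℕd<d z N) ⟨
  toℕ (residue N z)         ≡⟨ cong toℕ eq ⟩
  toℕ (residue N (z + + 1)) ≡⟨ toℕ-fromℕ< (n%ℕd<d (z + + 1) N) ⟩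
  (z + + 1) %ℕ N            ≡⟨ %ℕ-+ N z 1 ⟩
  (r ℕ.+ 1) ℕ.% N           ∎)
  where
  open ≡-Reasoning
  r : ℕ
  r = z %ℕ N
  r≢[r+1]%N : r ≢ (r ℕ.+ 1) ℕ.% N
  r≢[r+1]%N r≡ with ℕ.m≤n⇒m<n∨m≡n (subst (ℕ._≤ N) (ℕ.+-comm 1 r) (n%ℕd<d z N))
  ... | inj₁ r+1<N = ℕ.1+n≢n (sym (trans r≡ (trans (ℕ.m<n⇒m%n≡m r+1<N) (ℕ.+-comm r 1))))
  ... | inj₂ r+1≡N = ℕ.<-irrefl (trans (cong (ℕ._+ 1) (sym r≡0)) r+1≡N) 2≤N
    where
    r≡0 : r ≡ 0
    r≡0 = trans r≡ (trans (cong (ℕ._% N) r+1≡N) (ℕ.n%n≡0 N))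

nonZero⇒≢0 : ∀ i .{{_ : ℤ.NonZero i}} → i ≢ + 0
nonZero⇒≢0 (ℤ.+[1+ n ]) ()
nonZero⇒≢0 (-[1+ n ])   ()

1≤i*i : ∀ i .{{_ : ℤ.NonZero i}} → + 1 ℤ.≤ i * i
1≤i*i (ℤ.+[1+ n ]) = ℤ.+≤+ (s≤s z≤n)
1≤i*i (-[1+ n ])   = ℤ.+≤+ (s≤s z≤n)

i≤i*[j*j] : ∀ {i} j .{{_ : ℤ.NonZero j}} → + 0 ℤ.≤ i → i ℤ.≤ i * (j * j)
i≤i*[j*j] {i} j 0≤i = subst (ℤ._≤ i * (j * j)) (*-identityʳ i)
  (*-monoˡ-≤-nonNeg i {{ℤ.nonNegative 0≤i}} (1≤i*i j))

-- The quotient term rises by 1 along v = (a , b); the step across the line ℤ v is what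
-- rules out periods transverse to v.
level : (a b : ℤ) .{{_ : ℤ.NonZero a}} → Point → ℤ
level a b x = proj₁ x / a + step (det x (a , b))

level-shift : ∀ a b .{{_ : ℤ.NonZero a}} i z → level a b ((+ i ·P (a , b)) +P z) ≡ level a b z + + i
level-shift a b i (z₁ , z₂) =
  trans (cong₂ _+_ (/-shift a (+ i) z₁) (cong step (detShift a b (+ i) z₁ z₂))) (regroup (z₁ / a) (+ i) _)
  where
  detShift : ∀ a b i z₁ z₂ → (i * a + z₁) * b - (i * b + z₂) * a ≡ z₁ * b - z₂ * a
  detShift = solve-∀
  regroup : ∀ x i s → (x + i) + s ≡ (x + s) + i
  regroup = solve-∀

stripe : (a b : ℤ) .{{_ : ℤ.NonZero a}} (N : ℕ) .{{_ : ℕ.NonZero N}} → Word N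
stripe a b N x = residue N (level a b x)

stripe-rainbow : ∀ a b .{{_ : ℤ.NonZero a}} N .{{_ : ℕ.NonZero N}} → Rainbow (stripe a b N) (a , b) N
stripe-rainbow a b N z j =
  trans (sumTo-cong N (λ i _ → cong (λ x → δℕ x (toℕ j)) (letter i)))
        (sumTo-δℕ-% N (level a b z %ℕ N) (toℕ<n j))
  where
  letter : ∀ i → toℕ (stripe a b N ((+ i ·P (a , b)) +P z)) ≡ (level a b z %ℕ N ℕ.+ i) ℕ.% N
  letter i = begin
    toℕ (stripe a b N ((+ i ·P (a , b)) +P z)) ≡⟨ toℕ-fromℕ< (n%ℕd<d (level a b ((+ i ·P (a , b)) +P z)) N) ⟩
    level a b ((+ i ·P (a , b)) +P z) %ℕ N      ≡⟨ cong (_%ℕ N) (level-shift a b i z) ⟩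
    (level a b z + + i) %ℕ N                    ≡⟨ %ℕ-+ N (level a b z) i ⟩
    (level a b z %ℕ N ℕ.+ i) ℕ.% N              ∎
    where open ≡-Reasoning

IsPeriod-neg : ∀ {k} (w : Word k) p → IsPeriod w p → IsPeriod w (-P p)
IsPeriod-neg w (p₁ , p₂) period (x₁ , x₂) =
  trans (sym (period ((x₁ , x₂) -P (p₁ , p₂)))) (cong w (cong₂ _,_ (cancel x₁ p₁) (cancel x₂ p₂)))
  where
  cancel : ∀ x p → (x + - p) + p ≡ x
  cancel = solve-∀

-- With m = det p v > 0, the points 0 and (0 , m a) have the same level, but after adding p
-- only 0 crosses the step, since det((0 , m a) + p, v) = m − m a² ≤ 0.
stripe-period-det≯0 : ∀ a b .{{_ : ℤ.NonZero a}} N .{{_ : ℕ.NonZero N}} → 2 ℕ.≤ N →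
  ∀ p → IsPeriod (stripe a b N) p → ¬ (+ 0 ℤ.< det p (a , b))
stripe-period-det≯0 a b N 2≤N (p₁ , p₂) period 0<m =
  residue-suc-≢ N c 2≤N (begin
    residue N c                          ≡⟨ cong (residue N) (sym (+-identityʳ c)) ⟩
    residue N (c + + 0)                  ≡⟨ cong (λ s → residue N (c + s)) (sym (step-nonpos det[x+p]≤0)) ⟩
    stripe a b N (x +P (p₁ , p₂))         ≡⟨ period x ⟩
    stripe a b N x                       ≡⟨ cong (λ s → residue N (+ 0 / a + s)) (trans (step-nonpos det[x]≤0) (sym (step-nonpos det[0]≤0))) ⟩
    stripe a b N 0P                      ≡⟨ period 0P ⟨
    stripe a b N (0P +P (p₁ , p₂))        ≡⟨ cong (λ s → residue N (c + s)) (step-pos (subst (+ 0 ℤ.<_) (sym (det[0+p] p₁ p₂ a b)) 0<m)) ⟩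
    residue N (c + + 1)                  ∎)
  where
  open ≡-Reasoning
  m : ℤ
  m = det (p₁ , p₂) (a , b)
  c : ℤ
  c = (+ 0 + p₁) / a
  x : Point
  x = (+ 0 , m * a)
  m≤m*[a*a] : m ℤ.≤ m * (a * a)
  m≤m*[a*a] = i≤i*[j*j] a (<⇒≤ 0<m)
  det[x+p] : ∀ p₁ p₂ a b → (+ 0 + p₁) * b - ((p₁ * b - p₂ * a) * a + p₂) * a
                          ≡ (p₁ * b - p₂ * a) - (p₁ * b - p₂ * a) * (a * a)
  det[x+p] = solve-∀
  det[x] : ∀ m a b → + 0 * b - (m * a) * a ≡ + 0 - m * (a * a)
  det[x] = solve-∀
  det[0+p] : ∀ p₁ p₂ a b → (+ 0 + p₁) * b - (+ 0 + p₂) * a ≡ p₁ * b - p₂ * a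
  det[0+p] = solve-∀
  det[0] : ∀ a b → + 0 * b - + 0 * a ≡ + 0
  det[0] = solve-∀
  det[x+p]≤0 : det (x +P (p₁ , p₂)) (a , b) ℤ.≤ + 0
  det[x+p]≤0 = subst (ℤ._≤ + 0) (sym (det[x+p] p₁ p₂ a b)) (i≤j⇒i-j≤0 m≤m*[a*a])
  det[x]≤0 : det x (a , b) ℤ.≤ + 0
  det[x]≤0 = subst (ℤ._≤ + 0) (sym (det[x] m a b)) (i≤j⇒i-j≤0 (≤-trans (<⇒≤ 0<m) m≤m*[a*a]))
  det[0]≤0 : det 0P (a , b) ℤ.≤ + 0
  det[0]≤0 = subst (ℤ._≤ + 0) (sym (det[0] a b)) ≤-refl

stripe-period-det≡0 : ∀ a b .{{_ : ℤ.NonZero a}} N .{{_ : ℕ.NonZero N}} → 2 ℕ.≤ N →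
  ∀ p → IsPeriod (stripe a b N) p → det p (a , b) ≡ + 0
stripe-period-det≡0 a b N 2≤N p period with <-cmp (det p (a , b)) (+ 0)
... | tri< det<0 _ _ = ⊥-elim (stripe-period-det≯0 a b N 2≤N (-P p) (IsPeriod-neg (stripe a b N) p period)
                                 (subst (+ 0 ℤ.<_) (sym (det-neg p (a , b))) (neg-mono-< det<0)))
... | tri≈ _ det≡0 _ = det≡0
... | tri> _ _ 0<det = ⊥-elim (stripe-period-det≯0 a b N 2≤N p period 0<det)

stripe-aperiodic : ∀ a b .{{_ : ℤ.NonZero a}} N .{{_ : ℕ.NonZero N}} → 2 ℕ.≤ N → ¬ FullyPeriodic (stripe a b N)
stripe-aperiodic a b N 2≤N (p , q , independent , p-period , q-period) =
  independent (det-parallel p q (a , b) (λ v≡0 → nonZero⇒≢0 a (cong proj₁ v≡0))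
    (stripe-period-det≡0 a b N 2≤N p p-period) (stripe-period-det≡0 a b N 2≤N q q-period))

swapP : Point → Point
swapP (x₁ , x₂) = (x₂ , x₁)

Rainbow-swap : ∀ {k} (w : Word k) v m → Rainbow w (swapP v) m → Rainbow (w ∘ swapP) v m
Rainbow-swap w v m rainbow z = rainbow (swapP z)

FullyPeriodic-swap : ∀ {k} (w : Word k) → FullyPeriodic (w ∘ swapP) → FullyPeriodic w
FullyPeriodic-swap w ((p₁ , p₂) , (q₁ , q₂) , independent , p-period , q-period) =
  (p₂ , p₁) , (q₂ , q₁) , independent ∘ antisym , p-period ∘ swapP , q-period ∘ swapP
  where
  flip : ∀ x y → x - y ≡ - (y - x)
  flip = solve-∀
  antisym : p₂ * q₁ - p₁ * q₂ ≡ + 0 → p₁ * q₂ - p₂ * q₁ ≡ + 0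
  antisym det≡0 = trans (flip (p₁ * q₂) (p₂ * q₁)) (cong -_ det≡0)

aperiodicRainbowWord : ∀ v n → v ≢ 0P → 1 ℕ.≤ n →
  Σ (Word (suc n)) λ w → Rainbow w v (suc n) × ¬ FullyPeriodic w
aperiodicRainbowWord (a , b) n v≢0 (s≤s _) with a ≟ + 0
... | no a≢0 = let instance _ = ℤ.≢-nonZero a≢0 in
  stripe a b (suc n) , stripe-rainbow a b (suc n) , stripe-aperiodic a b (suc n) (s≤s (s≤s z≤n))
... | yes refl = let instance _ = ℤ.≢-nonZero (λ b≡0 → v≢0 (cong (+ 0 ,_) b≡0)) in
  stripe b (+ 0) (suc n) ∘ swapP ,
  Rainbow-swap (stripe b (+ 0) (suc n)) (+ 0 , b) (suc n) (stripe-rainbow b (+ 0) (suc n)) ,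
  stripe-aperiodic b (+ 0) (suc n) (s≤s (s≤s z≤n)) ∘ FullyPeriodic-swap (stripe b (+ 0) (suc n))

theorem3 : (F : RawFigure) → IsFigure F → HasNontrivialStronglyLinearDivisor F →
    Σ ℕ λ k → Σ (Word k) λ w → ¬ FullyPeriodic w × AbelianComplexityOne w F
theorem3 F _ (v , n , v≢0 , 1≤n , l∣Poly) with aperiodicRainbowWord v n v≢0 1≤n
... | w , rainbow , aperiodic =
  suc n , w , aperiodic ,
  balanced-divisor⇒abelianComplexityOne w F (strongLinear v n) l∣Poly (rainbow⇒balanced w v n rainbow)
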